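{- Let $l\ge2$ and $N=l^2$. Then the $2l$-tuple $(l,l,\dots,l)\in(\mathbb{Z}/N\mathbb{Z})^{2l}$ is a solution of $(E_N)$.
   Context: For $a_1,\dots,a_n\in\mathbb{Z}/N\mathbb{Z}$ set $M_n(a_1,\dots,a_n)=\begin{pmatrix}a_n&-1\\1&0\end{pmatrix}\cdots\begin{pmatrix}a_1&-1\\1&0\end{pmatrix}$. An $n$-tuple is a solution of $(E_N)$ if $M_n(a_1,\dots,a_n)=\pm\mathrm{Id}$ over $\mathbb{Z}/N\mathbb{Z}$. -}

module Defs where

open import Data.Nat using (ℕ)
open import Data.Integer using (ℤ; +_; _+_; _*_; -_; _-_)
open import Data.Integer.Divisibility using (_∣_)
open import Data.List using (List; []; _∷_; replicate)
open import Data.Product using (_×_)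
open import Data.Sum using (_⊎_)

record Mat2 : Set where
  constructor mat
  field
    m11 m12 m21 m22 : ℤ
open Mat2 public

_⊗_ : Mat2 → Mat2 → Mat2
mat a b c d ⊗ mat e f g h =
  mat (a * e + b * g) (a * f + b * h) (c * e + d * g) (c * f + d * h)

idM : Mat2
idM = mat (+ 1) (+ 0) (+ 0) (+ 1)

negIdM : Mat2
negIdM = mat (- + 1) (+ 0) (+ 0) (- + 1)

S : ℤ → Mat2
S a = mat a (- + 1) (+ 1) (+ 0)

-- M_n(a_1,…,a_n) = S(a_n) ⋯ S(a_1), the list being [a_1, …, a_n]
M : List ℤ → Mat2
M []       = idM
M (a ∷ as) = M as ⊗ S a

_≡M_[mod_] : Mat2 → Mat2 → ℕ → Set
A ≡M B [mod N ] =
  ((+ N) ∣ (m11 A - m11 B)) × ((+ N) ∣ (m12 A - m12 B)) ×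
  ((+ N) ∣ (m21 A - m21 B)) × ((+ N) ∣ (m22 A - m22 B))

-- (a_1,…,a_n) (representatives in ℤ) is a solution of (E_N)
IsSolution : ℕ → List ℤ → Set
IsSolution N as = (M as ≡M idM [mod N ]) ⊎ (M as ≡M negIdM [mod N ])

-- Modulo l², the square S(l)² = (l² − 1, −l ; l, −1) is −(I + lK) with K = (0, 1 ; −1, 0).
-- Since K² = −I, the error term of a product of two matrices of the shape ±(I + c l K) is a
-- multiple of l², so S(l)^(2k) ≡ (−1)^k (I + k l K), and for k = l the K-part vanishes mod l².
module Submission where

open import Defs
open import Data.Nat using (ℕ; zero; suc; _≤_; _+_; _*_)
open import Data.Integer using (ℤ; +_; _-_; -_)
import Data.Integer as ℤ
import Data.Integer.Properties as ℤₚ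
open import Data.Integer.Divisibility.Signed
  using (divides; ∣ᵤ⇒∣; ∣⇒∣ᵤ; ∣m∣n⇒∣m+n; ∣m⇒∣m*n)
import Data.Integer.Divisibility as Unsigned
open import Data.Integer.Tactic.RingSolver using (solve-∀)
open import Data.List using (replicate)
open import Data.Nat.Properties using (+-suc)
open import Data.Product using (_,_)
open import Function using (_∘_; _$_)
open import Data.Sum using (_⊎_; inj₁; inj₂)
open import Relation.Binary.PropositionalEquality using (_≡_; refl; sym; cong; subst)

infixl 6 _⊕_
infixl 7 _⊛_
_⊕_ _⊛_ : ℤ → ℤ → ℤ
_⊕_ = ℤ._+_
_⊛_ = ℤ._*_

∣-sum : ∀ {N} x y {z} → (+ N) Unsigned.∣ x → (+ N) Unsigned.∣ y → z ≡ x ⊕ y → (+ N) Unsigned.∣ z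
∣-sum {N} x y x∣ y∣ refl = ∣⇒∣ᵤ (∣m∣n⇒∣m+n (∣ᵤ⇒∣ {+ N} {x} x∣) (∣ᵤ⇒∣ {+ N} {y} y∣))

∣-multiple-sq : ∀ l {z} q → z ≡ q ⊛ (+ l ⊛ + l) → (+ (l * l)) Unsigned.∣ z
∣-multiple-sq l {z} q eq = subst (Unsigned._∣ z) (sym (ℤₚ.pos-* l l)) (∣⇒∣ᵤ (divides q eq))

-- The matrices cannot be inferred from a product of divisibilities; wrapping it in a record
-- makes them recoverable by unification.
record _≈M_[mod_] (A B : Mat2) (N : ℕ) : Set where
  constructor ≡M⇒≈M
  field ≈M⇒≡M : A ≡M B [mod N ]
open _≈M_[mod_]

≈M-refl : ∀ {N} A → A ≈M A [mod N ]
≈M-refl {N} (mat a b c d) = ≡M⇒≈M $ zero-diff a , zero-diff b , zero-diff c , zero-diff d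
  where
  a-a≡0 : ∀ a n → a - a ≡ + 0 ⊛ n
  a-a≡0 = solve-∀
  zero-diff : ∀ a → (+ N) Unsigned.∣ a - a
  zero-diff a = ∣⇒∣ᵤ {+ N} (divides (+ 0) (a-a≡0 a (+ N)))

≈M-trans : ∀ {N A B C} → A ≈M B [mod N ] → B ≈M C [mod N ] → A ≈M C [mod N ]
≈M-trans {N} {mat a₁₁ a₁₂ a₂₁ a₂₂} {mat b₁₁ b₁₂ b₂₁ b₂₂} {mat c₁₁ c₁₂ c₂₁ c₂₂}
         (≡M⇒≈M (d₁₁ , d₁₂ , d₂₁ , d₂₂)) (≡M⇒≈M (e₁₁ , e₁₂ , e₂₁ , e₂₂)) = ≡M⇒≈M $
  chain a₁₁ b₁₁ c₁₁ d₁₁ e₁₁ , chain a₁₂ b₁₂ c₁₂ d₁₂ e₁₂ ,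
  chain a₂₁ b₂₁ c₂₁ d₂₁ e₂₁ , chain a₂₂ b₂₂ c₂₂ d₂₂ e₂₂
  where
  telescope : ∀ a b c → a - c ≡ (a - b) ⊕ (b - c)
  telescope = solve-∀
  chain : ∀ a b c → (+ N) Unsigned.∣ a - b → (+ N) Unsigned.∣ b - c → (+ N) Unsigned.∣ a - c
  chain a b c a≡b b≡c = ∣-sum (a - b) (b - c) a≡b b≡c (telescope a b c)

⊗-congʳ : ∀ {N A A′ B} → A ≈M A′ [mod N ] → (A ⊗ B) ≈M (A′ ⊗ B) [mod N ]
⊗-congʳ {N} {mat a₁₁ a₁₂ a₂₁ a₂₂} {mat a′₁₁ a′₁₂ a′₂₁ a′₂₂} {mat e f g h}
        (≡M⇒≈M (d₁₁ , d₁₂ , d₂₁ , d₂₂)) = ≡M⇒≈M $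
  row a₁₁ a₁₂ a′₁₁ a′₁₂ d₁₁ d₁₂ e g , row a₁₁ a₁₂ a′₁₁ a′₁₂ d₁₁ d₁₂ f h ,
  row a₂₁ a₂₂ a′₂₁ a′₂₂ d₂₁ d₂₂ e g , row a₂₁ a₂₂ a′₂₁ a′₂₂ d₂₁ d₂₂ f h
  where
  expand : ∀ a b a′ b′ e g → (a ⊛ e ⊕ b ⊛ g) - (a′ ⊛ e ⊕ b′ ⊛ g) ≡ (a - a′) ⊛ e ⊕ (b - b′) ⊛ g
  expand = solve-∀
  row : ∀ a b a′ b′ → (+ N) Unsigned.∣ a - a′ → (+ N) Unsigned.∣ b - b′ →
        ∀ e g → (+ N) Unsigned.∣ (a ⊛ e ⊕ b ⊛ g) - (a′ ⊛ e ⊕ b′ ⊛ g)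
  row a b a′ b′ da db e g =
    ∣-sum ((a - a′) ⊛ e) ((b - b′) ⊛ g)
          (∣⇒∣ᵤ (∣m⇒∣m*n e (∣ᵤ⇒∣ {+ N} {a - a′} da)))
          (∣⇒∣ᵤ (∣m⇒∣m*n g (∣ᵤ⇒∣ {+ N} {b - b′} db)))
          (expand a b a′ b′ e g)

-- s (I + c K) with K = (0, 1 ; −1, 0)
nearScalar : ℤ → ℤ → Mat2
nearScalar s c = mat s (s ⊛ c) (- (s ⊛ c)) s

scalar : ℤ → Mat2
scalar s = mat s (+ 0) (+ 0) s

nearScalar-⊗-S²-≈M : ∀ s c l →
  ((nearScalar s (c ⊛ + l) ⊗ S (+ l)) ⊗ S (+ l)) ≈M nearScalar (- s) ((+ 1 ⊕ c) ⊛ + l) [mod l * l ]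
nearScalar-⊗-S²-≈M s c l = ≡M⇒≈M $
  ∣-multiple-sq l (s ⊕ s ⊛ c) (e₁₁ s c (+ l)) , ∣-multiple-sq l (+ 0) (e₁₂ s c (+ l)) ,
  ∣-multiple-sq l (- (s ⊛ c ⊛ + l)) (e₂₁ s c (+ l)) , ∣-multiple-sq l (s ⊛ c) (e₂₂ s c (+ l))
  where
  e₁₁ : ∀ s c a → ((s ⊛ a ⊕ s ⊛ (c ⊛ a) ⊛ + 1) ⊛ a ⊕ (s ⊛ (- + 1) ⊕ s ⊛ (c ⊛ a) ⊛ + 0) ⊛ + 1) - - s
                  ≡ (s ⊕ s ⊛ c) ⊛ (a ⊛ a)
  e₁₁ = solve-∀
  e₁₂ : ∀ s c a → ((s ⊛ a ⊕ s ⊛ (c ⊛ a) ⊛ + 1) ⊛ (- + 1) ⊕ (s ⊛ (- + 1) ⊕ s ⊛ (c ⊛ a) ⊛ + 0) ⊛ + 0)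
                    - (- s ⊛ ((+ 1 ⊕ c) ⊛ a))
                  ≡ + 0 ⊛ (a ⊛ a)
  e₁₂ = solve-∀
  e₂₁ : ∀ s c a → ((- (s ⊛ (c ⊛ a)) ⊛ a ⊕ s ⊛ + 1) ⊛ a ⊕ (- (s ⊛ (c ⊛ a)) ⊛ (- + 1) ⊕ s ⊛ + 0) ⊛ + 1)
                    - (- (- s ⊛ ((+ 1 ⊕ c) ⊛ a)))
                  ≡ - (s ⊛ c ⊛ a) ⊛ (a ⊛ a)
  e₂₁ = solve-∀
  e₂₂ : ∀ s c a → ((- (s ⊛ (c ⊛ a)) ⊛ a ⊕ s ⊛ + 1) ⊛ (- + 1) ⊕ (- (s ⊛ (c ⊛ a)) ⊛ (- + 1) ⊕ s ⊛ + 0) ⊛ + 0)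
                    - - s
                  ≡ s ⊛ c ⊛ (a ⊛ a)
  e₂₂ = solve-∀

nearScalar-l²-≈M-scalar : ∀ s l → nearScalar s (+ l ⊛ + l) ≈M scalar s [mod l * l ]
nearScalar-l²-≈M-scalar s l = ≡M⇒≈M $
  ∣-multiple-sq l (+ 0) (e₁₁ s (+ l)) , ∣-multiple-sq l s (e₁₂ s (+ l)) ,
  ∣-multiple-sq l (- s) (e₂₁ s (+ l)) , ∣-multiple-sq l (+ 0) (e₁₁ s (+ l))
  where
  e₁₁ : ∀ s a → s - s ≡ + 0 ⊛ (a ⊛ a)
  e₁₁ = solve-∀
  e₁₂ : ∀ s a → s ⊛ (a ⊛ a) - + 0 ≡ s ⊛ (a ⊛ a)
  e₁₂ = solve-∀
  e₂₁ : ∀ s a → - (s ⊛ (a ⊛ a)) - + 0 ≡ - s ⊛ (a ⊛ a)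
  e₂₁ = solve-∀

alternating : ℕ → ℤ
alternating zero    = + 1
alternating (suc k) = - alternating k

alternating≡±1 : ∀ k → alternating k ≡ + 1 ⊎ alternating k ≡ - + 1
alternating≡±1 zero = inj₁ refl
alternating≡±1 (suc k) with alternating≡±1 k
... | inj₁ s≡1  = inj₂ (cong -_ s≡1)
... | inj₂ s≡-1 = inj₁ (cong -_ s≡-1)

M-replicate-2k-≈M : ∀ l k →
  M (replicate (2 * k) (+ l)) ≈M nearScalar (alternating k) (+ k ⊛ + l) [mod l * l ]
M-replicate-2k-≈M l zero = ≈M-refl idM
M-replicate-2k-≈M l (suc k) rewrite +-suc k (k + 0) =
  ≈M-trans (⊗-congʳ (⊗-congʳ (M-replicate-2k-≈M l k)))
           (nearScalar-⊗-S²-≈M (alternating k) (+ k) l)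

IsSolution-of-≈M-scalar : ∀ {N as s} → s ≡ + 1 ⊎ s ≡ - + 1 →
                          M as ≈M scalar s [mod N ] → IsSolution N as
IsSolution-of-≈M-scalar (inj₁ refl) = inj₁ ∘ ≈M⇒≡M
IsSolution-of-≈M-scalar (inj₂ refl) = inj₂ ∘ ≈M⇒≡M

proposition3p10 : (l : ℕ) → 2 ≤ l → IsSolution (l * l) (replicate (2 * l) (+ l))
proposition3p10 l _ =
  IsSolution-of-≈M-scalar (alternating≡±1 l)
    (≈M-trans (M-replicate-2k-≈M l l) (nearScalar-l²-≈M-scalar (alternating l) l))
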